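{- Let $G$ be a connected graph and let $e=u_1u_2$ be a bridge of $G$ with $\deg_G(u_1)\ge 2$ and $\deg_G(u_2)\ge 2$. Let $G_1,G_2$ be the two components of $G-e$, where $u_i\in V(G_i)$ for $i\in\{1,2\}$. Then ${\rm gp}(G)\ge \xi_{G_1}(u_1)+\xi_{G_2}(u_2)$. Moreover, if $G$ is a block graph (containing at least one bridge), then equality ${\rm gp}(G)= \xi_{G_1}(u_1)+\xi_{G_2}(u_2)$ holds for every such bridge.
   Context: All graphs are finite, simple and connected. For vertices $x,y$ of a graph $G$, $d_G(x,y)$ is the distance and $I_G[x,y]=\{w: d_G(x,y)=d_G(x,w)+d_G(w,y)\}$. A set $X\subseteq V(G)$ is a general position set if every shortest path $P$ of $G$ satisfies $|V(P)\cap X|\le 2$; ${\rm gp}(G)$ is the maximum cardinality of a general position set. For $u\in V(G)$, a set $S\subseteq V(G)$ is $u$-colinear if $S$ is a general position set, $u\notin S$, and $y\notin I_G[x,u]$ for all distinct $x,y\in S$; $\xi_G(u)$ is the maximum cardinality of a $u$-colinear set of $G$. A block graph is a connected graph in which every block (maximal 2-connected subgraph or bridge) is a complete graph. -}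

module Defs where

open import Data.Nat using (ℕ; zero; suc; _+_; _≤_)
open import Data.Fin using (Fin)
open import Data.Fin.Subset using (Subset; _∈_; _∉_; _⊆_; ∣_∣; ⊤)
open import Data.Vec using (lookup; tabulate)
open import Data.Bool using (Bool; true; false; if_then_else_)
open import Data.List using (List; []; _∷_)
open import Data.Product using (Σ; ∃; _×_; _,_)
open import Data.Sum using (_⊎_)
open import Data.Unit using () renaming (⊤ to Unit)
open import Relation.Nullary using (¬_)
open import Relation.Binary.PropositionalEquality using (_≡_; _≢_)

record Graph (n : ℕ) : Set where
  field
    E      : Fin n → Fin n → Bool
    sym    : ∀ x y → E x y ≡ E y x
    irrefl : ∀ x → E x x ≡ false

open Graph public

Rel : ℕ → Set₁
Rel n = Fin n → Fin n → Set

Adj : ∀ {n} → Graph n → Rel n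
Adj G x y = E G x y ≡ true

AdjMinus : ∀ {n} → Graph n → Fin n → Fin n → Rel n
AdjMinus G a b x y = Adj G x y × ¬ ((x ≡ a × y ≡ b) ⊎ (x ≡ b × y ≡ a))

Induced : ∀ {n} → Rel n → (Fin n → Set) → Rel n
Induced R P x y = P x × P y × R x y

data Walk {n : ℕ} (R : Rel n) : Fin n → Fin n → ℕ → Set where
  nil  : ∀ {x} → Walk R x x 0
  cons : ∀ {x y z k} → R x y → Walk R y z k → Walk R x z (suc k)

verts : ∀ {n} {R : Rel n} {x y k} → Walk R x y k → List (Fin n)
verts (nil {x = x}) = x ∷ []
verts (cons {x = x} _ w) = x ∷ verts w

countIn : ∀ {n} → Subset n → List (Fin n) → ℕ
countIn X [] = 0
countIn X (v ∷ vs) = if lookup X v then suc (countIn X vs) else countIn X vs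

IsDist : ∀ {n} → Rel n → Fin n → Fin n → ℕ → Set
IsDist R x y d = Walk R x y d × (∀ k → Walk R x y k → d ≤ k)

InInterval : ∀ {n} → Rel n → Fin n → Fin n → Fin n → Set
InInterval R x y w = Σ ℕ λ a → Σ ℕ λ b → Σ ℕ λ c →
  IsDist R x y a × IsDist R x w b × IsDist R w y c × a ≡ b + c

Connected : ∀ {n} → Rel n → (Fin n → Set) → Set
Connected R P = ∀ x y → P x → P y → ∃ λ k → Walk (Induced R P) x y k

ConnectedGraph : ∀ {n} → Graph n → Set
ConnectedGraph G = Connected (Adj G) (λ _ → Unit)

IsGP : ∀ {n} → Rel n → Subset n → Subset n → Set
IsGP R C X = X ⊆ C ×
  (∀ x y k (w : Walk R x y k) → IsDist R x y k → countIn X (verts w) ≤ 2)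

IsColinear : ∀ {n} → Rel n → Subset n → Fin n → Subset n → Set
IsColinear R C u S = IsGP R C S × u ∉ S ×
  (∀ x y → x ∈ S → y ∈ S → x ≢ y → ¬ InInterval R x u y)

IsMaxCard : ∀ {n} → (Subset n → Set) → ℕ → Set
IsMaxCard P m = (Σ _ λ S → P S × ∣ S ∣ ≡ m) × (∀ S → P S → ∣ S ∣ ≤ m)

IsGpNumber : ∀ {n} → Graph n → ℕ → Set
IsGpNumber G m = IsMaxCard (IsGP (Adj G) ⊤) m

IsXi : ∀ {n} → Rel n → Subset n → Fin n → ℕ → Set
IsXi R C u m = IsMaxCard (IsColinear R C u) m

degree : ∀ {n} → Graph n → Fin n → ℕ
degree G u = ∣ tabulate (E G u) ∣

IsBridge : ∀ {n} → Graph n → Fin n → Fin n → Set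
IsBridge G a b = Adj G a b × ¬ (∃ λ k → Walk (AdjMinus G a b) a b k)

IsComponentOf : ∀ {n} → Rel n → Fin n → Subset n → Set
IsComponentOf R u C = ∀ v → (v ∈ C → ∃ λ k → Walk R u v k) × ((∃ λ k → Walk R u v k) → v ∈ C)

-- G[B] is 2-connected or a bridge (K2): at least two vertices, connected, no cut vertex
IsBiconnected : ∀ {n} → Graph n → Subset n → Set
IsBiconnected G B = 2 ≤ ∣ B ∣ × Connected (Adj G) (_∈ B) ×
  (∀ v → v ∈ B → Connected (Adj G) (λ x → x ∈ B × x ≢ v))

IsBlock : ∀ {n} → Graph n → Subset n → Set
IsBlock G B = IsBiconnected G B × (∀ B' → B ⊆ B' → IsBiconnected G B' → B' ⊆ B)

IsBlockGraph : ∀ {n} → Graph n → Set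
IsBlockGraph G = ∀ B → IsBlock G B → ∀ x y → x ∈ B → y ∈ B → x ≢ y → Adj G x y

{-# OPTIONS --safe #-}
module Submission where

-- Lower bound: if Sᵢ is uᵢ-colinear in Gᵢ, then S₁ ∪ S₂ is in general position in G, because a
-- geodesic of G either stays in one Gᵢ, where it is a geodesic of Gᵢ, or crosses the bridge once
-- and splits into geodesics of G₁ and G₂ ending at u₁ and u₂, each meeting S₁ ∪ S₂ at most once.
--
-- Upper bound for block graphs: let X be in general position in G. If X meets both sides, each
-- trace X ∩ V(Gᵢ) is uᵢ-colinear or equal to {uᵢ}, since a vertex of X beyond the bridge extends
-- every geodesic ending at uᵢ. If X lies in one side Gᵢ, removing a single vertex makes it
-- uᵢ-colinear: in a block graph a vertex y strictly inside I[x,u] separates x from u, which forces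
-- all pairs x, y of X with y ∈ I[x,u] to share the same y. The degree condition gives ξ(uᵢ) ≥ 1,
-- which pays for the removed vertex.

open import Data.Bool using (true; false; _∨_)
import Data.Bool as Bool
open import Data.Empty using (⊥; ⊥-elim)
open import Data.Fin using (Fin; zero)
open import Data.Fin.Properties using (any?) renaming (_≟_ to _≟ᶠ_)
open import Data.Fin.Subset
  using (Subset; _∈_; _∉_; _⊆_; ∣_∣; ⁅_⁆; ⊤; _∪_; _∩_; _─_; _-_; Nonempty; Empty; inside; outside)
  renaming (⊥ to ∅)
open import Data.Fin.Subset.Properties
  using ( _∈?_; ∈⊤; x∈⁅x⁆; x∈⁅y⁆⇒x≡y; x∉⁅y⁆⇒x≢y; ∣⁅x⁆∣≡1; ∣⊥∣≡0; ∣p∣≤n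
        ; p⊆q⇒∣p∣≤∣q∣; p⊂q⇒∣p∣<∣q∣; x∈p∩q⁺; x∈p∩q⁻; p∩q⊆p; p∩q⊆q; ∣p∩q∣≤∣q∣
        ; p─q⊆p; x∈p∧x≢y⇒x∈p-y; x∈p⇒∣p-x∣<∣p∣; nonempty?; Empty-unique; drop-∷-Empty )
open import Data.List using (List; []; _∷_; _++_; _∷ʳ_; reverse)
open import Data.List.Properties using (unfold-reverse)
open import Data.List.Membership.Propositional using () renaming (_∈_ to _∈ᴸ_; _∉_ to _∉ᴸ_)
open import Data.List.Relation.Binary.Subset.Propositional using () renaming (_⊆_ to _⊆ᴸ_)
open import Data.List.Relation.Unary.Any using (here; there)
import Data.List.Relation.Unary.Any as Any
open import Data.List.Relation.Unary.Any.Properties using (reverse⁻)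
open import Data.List.Membership.Propositional.Properties using (∈-++⁻)
open import Data.Nat using (ℕ; zero; suc; _+_; _≤_; _<_; z≤n; s≤s)
open import Data.Nat.Induction using (<-rec)
open import Data.Nat.Properties
open import Data.Product using (Σ-syntax; ∃; ∃-syntax; _×_; _,_; proj₁; proj₂)
open import Data.Sum using (_⊎_; inj₁; inj₂; [_,_]; map₁)
open import Data.Unit using (tt)
open import Data.Vec using (_∷_; []; lookup; tabulate)
import Data.Vec.Base as Vec
open import Data.Vec.Properties using ([]=⇒lookup; lookup⇒[]=; lookup-zipWith; lookup∘tabulate)
open import Function using (_∘_; id)
open import Relation.Binary.Definitions using (Symmetric; Decidable)
open import Relation.Binary.PropositionalEquality
  using (_≡_; _≢_; refl; sym; trans; cong; cong₂; subst; module ≡-Reasoning)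
open import Relation.Nullary using (¬_; Dec; yes; no; does; contradiction; ¬¬-map)
open import Relation.Nullary.Decidable
  using (map′; _×-dec_; _⊎-dec_; ¬?; dec-true; decidable-stable; ¬¬-excluded-middle)

open import Defs hiding (sym)

private variable
  n k l m : ℕ
  x y z t v : Fin n
  R : Rel n
  X Y : Subset n

-- Subsets

∣p─q∣+∣p∩q∣≡∣p∣ : (p q : Subset n) → ∣ p ─ q ∣ + ∣ p ∩ q ∣ ≡ ∣ p ∣
∣p─q∣+∣p∩q∣≡∣p∣ [] [] = refl
∣p─q∣+∣p∩q∣≡∣p∣ (inside ∷ p) (inside ∷ q) = trans (+-suc _ _) (cong suc (∣p─q∣+∣p∩q∣≡∣p∣ p q))
∣p─q∣+∣p∩q∣≡∣p∣ (inside ∷ p) (outside ∷ q) = cong suc (∣p─q∣+∣p∩q∣≡∣p∣ p q)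
∣p─q∣+∣p∩q∣≡∣p∣ (outside ∷ p) (inside ∷ q) = ∣p─q∣+∣p∩q∣≡∣p∣ p q
∣p─q∣+∣p∩q∣≡∣p∣ (outside ∷ p) (outside ∷ q) = ∣p─q∣+∣p∩q∣≡∣p∣ p q

x∈p─q⇒x∉q : {p q : Subset n} → x ∈ p ─ q → x ∉ q
x∈p─q⇒x∉q {p = _ ∷ _} {outside ∷ _} Vec.here ()
x∈p─q⇒x∉q {p = _ ∷ _} {_ ∷ _} (Vec.there x∈) (Vec.there x∈q) = x∈p─q⇒x∉q x∈ x∈q

x∈p-y⇒x≢y : {p : Subset n} → x ∈ p - y → x ≢ y
x∈p-y⇒x≢y = x∉⁅y⁆⇒x≢y ∘ x∈p─q⇒x∉q

x∈p-y⇒x∈p : {p : Subset n} → x ∈ p - y → x ∈ p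
x∈p-y⇒x∈p {y = y} {p = p} = p─q⊆p p ⁅ y ⁆

∣p∣≤∣p-x∣+1 : (p : Subset n) (x : Fin n) → ∣ p ∣ ≤ ∣ p - x ∣ + 1
∣p∣≤∣p-x∣+1 p x = begin
  ∣ p ∣                    ≡⟨ ∣p─q∣+∣p∩q∣≡∣p∣ p ⁅ x ⁆ ⟨
  ∣ p - x ∣ + ∣ p ∩ ⁅ x ⁆ ∣  ≤⟨ +-monoʳ-≤ ∣ p - x ∣ (∣p∩q∣≤∣q∣ p ⁅ x ⁆) ⟩
  ∣ p - x ∣ + ∣ ⁅ x ⁆ ∣      ≡⟨ cong (∣ p - x ∣ +_) (∣⁅x⁆∣≡1 x) ⟩
  ∣ p - x ∣ + 1            ∎
  where open ≤-Reasoning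

∣p∪q∣≡∣p∣+∣q∣ : (p q : Subset n) → Empty (p ∩ q) → ∣ p ∪ q ∣ ≡ ∣ p ∣ + ∣ q ∣
∣p∪q∣≡∣p∣+∣q∣ [] [] _ = refl
∣p∪q∣≡∣p∣+∣q∣ (inside ∷ p) (inside ∷ q) disj = ⊥-elim (disj (zero , Vec.here))
∣p∪q∣≡∣p∣+∣q∣ (inside ∷ p) (outside ∷ q) disj = cong suc (∣p∪q∣≡∣p∣+∣q∣ p q (drop-∷-Empty disj))
∣p∪q∣≡∣p∣+∣q∣ (outside ∷ p) (inside ∷ q) disj =
  trans (cong suc (∣p∪q∣≡∣p∣+∣q∣ p q (drop-∷-Empty disj))) (sym (+-suc ∣ p ∣ ∣ q ∣))
∣p∪q∣≡∣p∣+∣q∣ (outside ∷ p) (outside ∷ q) disj = ∣p∪q∣≡∣p∣+∣q∣ p q (drop-∷-Empty disj)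

two-elements⇒2≤∣p∣ : {p : Subset n} → x ∈ p → y ∈ p → x ≢ y → 2 ≤ ∣ p ∣
two-elements⇒2≤∣p∣ {x = x} {y} {p} x∈p y∈p x≢y = ≤-trans (s≤s 1≤∣p-x∣) (x∈p⇒∣p-x∣<∣p∣ x∈p)
  where
  1≤∣p-x∣ : 1 ≤ ∣ p - x ∣
  1≤∣p-x∣ = subst (_≤ ∣ p - x ∣) (∣⁅x⁆∣≡1 y) (p⊆q⇒∣p∣≤∣q∣ λ z∈⁅y⁆ →
    subst (_∈ p - x) (sym (x∈⁅y⁆⇒x≡y y z∈⁅y⁆)) (x∈p∧x≢y⇒x∈p-y y∈p (x≢y ∘ sym)))

2≤∣p∣⇒other-element : ∀ {n} (p : Subset n) (x : Fin n) → 2 ≤ ∣ p ∣ → ∃[ y ] y ∈ p × y ≢ x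
2≤∣p∣⇒other-element {n} p x 2≤∣p∣ with nonempty? (p - x)
... | yes (y , y∈p-x) = y , p─q⊆p p ⁅ x ⁆ y∈p-x , x∈p-y⇒x≢y y∈p-x
... | no p-x-empty = contradiction 2≤∣p∣ (<⇒≱ (s≤s (begin
  ∣ p ∣             ≤⟨ ∣p∣≤∣p-x∣+1 p x ⟩
  ∣ p - x ∣ + 1     ≡⟨ cong (λ q → ∣ q ∣ + 1) (Empty-unique p-x-empty) ⟩
  ∣ ∅ {n} ∣ + 1     ≡⟨ cong (_+ 1) (∣⊥∣≡0 n) ⟩
  1                 ∎)))
  where open ≤-Reasoning

decSubset : {P : Fin n → Set} → (∀ v → Dec (P v)) → Subset n
decSubset P? = tabulate (does ∘ P?)

∈-decSubset⁺ : {P : Fin n → Set} (P? : ∀ v → Dec (P v)) → P v → v ∈ decSubset P?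
∈-decSubset⁺ {v = v} P? P-v = lookup⇒[]= v _ (trans (lookup∘tabulate _ v) (dec-true (P? v) P-v))

∈-decSubset⁻ : {P : Fin n → Set} (P? : ∀ v → Dec (P v)) → v ∈ decSubset P? → P v
∈-decSubset⁻ {v = v} P? v∈ with P? v | trans (sym ([]=⇒lookup v∈)) (lookup∘tabulate (does ∘ P?) v)
... | yes P-v | _ = P-v
... | no _ | ()

-- Counting the vertices of a list that lie in a set

private variable
  xs : List (Fin n)

lookup-∉ : x ∉ X → lookup X x ≡ false
lookup-∉ {x = x} {X} x∉X with lookup X x in eq
... | true = contradiction (lookup⇒[]= x X eq) x∉X
... | false = refl

countIn-++ : ∀ (X : Subset n) xs ys → countIn X (xs ++ ys) ≡ countIn X xs + countIn X ys
countIn-++ X [] ys = refl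
countIn-++ X (v ∷ xs) ys with lookup X v
... | true = cong suc (countIn-++ X xs ys)
... | false = countIn-++ X xs ys

countIn-reverse : ∀ (X : Subset n) xs → countIn X (reverse xs) ≡ countIn X xs
countIn-reverse X [] = refl
countIn-reverse X (v ∷ xs) = begin
  countIn X (reverse (v ∷ xs))                 ≡⟨ cong (countIn X) (unfold-reverse v xs) ⟩
  countIn X (reverse xs ++ v ∷ [])             ≡⟨ countIn-++ X (reverse xs) (v ∷ []) ⟩
  countIn X (reverse xs) + countIn X (v ∷ [])  ≡⟨ cong (_+ _) (countIn-reverse X xs) ⟩
  countIn X xs + countIn X (v ∷ [])            ≡⟨ +-comm (countIn X xs) _ ⟩
  countIn X (v ∷ []) + countIn X xs            ≡⟨ head-count ⟩
  countIn X (v ∷ xs)                           ∎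
  where
  open ≡-Reasoning
  head-count : countIn X (v ∷ []) + countIn X xs ≡ countIn X (v ∷ xs)
  head-count with lookup X v
  ... | true = refl
  ... | false = refl

lookup-⊆ : X ⊆ Y → lookup X x ≡ true → lookup Y x ≡ true
lookup-⊆ {X = X} {x = x} X⊆Y x∈X = []=⇒lookup (X⊆Y (lookup⇒[]= x X x∈X))

countIn-mono : X ⊆ Y → ∀ xs → countIn X xs ≤ countIn Y xs
countIn-mono X⊆Y [] = z≤n
countIn-mono {X = X} {Y} X⊆Y (v ∷ xs) with lookup X v in v∈X | lookup Y v in v∈Y
... | true | true = s≤s (countIn-mono X⊆Y xs)
... | true | false = contradiction (trans (sym (lookup-⊆ X⊆Y v∈X)) v∈Y) λ ()
... | false | true = m≤n⇒m≤1+n (countIn-mono X⊆Y xs)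
... | false | false = countIn-mono X⊆Y xs

countIn-∪ : ∀ (X Y : Subset n) xs → countIn (X ∪ Y) xs ≤ countIn X xs + countIn Y xs
countIn-∪ X Y [] = z≤n
countIn-∪ X Y (v ∷ xs) rewrite lookup-zipWith _∨_ v X Y with lookup X v | lookup Y v
... | true | true = s≤s (≤-trans (countIn-∪ X Y xs) (+-monoʳ-≤ (countIn X xs) (n≤1+n _)))
... | true | false = s≤s (countIn-∪ X Y xs)
... | false | true = ≤-trans (s≤s (countIn-∪ X Y xs)) (≤-reflexive (sym (+-suc _ _)))
... | false | false = countIn-∪ X Y xs

countIn-≡0 : (∀ {t} → t ∈ᴸ xs → t ∉ X) → countIn X xs ≡ 0
countIn-≡0 {xs = []} _ = refl
countIn-≡0 {xs = v ∷ xs} {X = X} disjoint rewrite lookup-∉ (disjoint (here refl)) =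
  countIn-≡0 (disjoint ∘ there)

countIn-∷-≤1 : ∀ (X : Subset n) x xs → (x ∈ X → countIn X xs ≡ 0) → countIn X xs ≤ 1 →
  countIn X (x ∷ xs) ≤ 1
countIn-∷-≤1 X x xs rest≡0 rest≤1 with lookup X x in x∈X
... | true rewrite rest≡0 (lookup⇒[]= x X x∈X) = s≤s z≤n
... | false = rest≤1

countIn-remove-< : x ∈ᴸ xs → x ∈ X → countIn (X - x) xs < countIn X xs
countIn-remove-< {x = x} {xs = _ ∷ xs} {X} (here refl) x∈X
  rewrite []=⇒lookup x∈X | lookup-∉ {X = X - x} (λ x∈X-x → x∈p-y⇒x≢y {p = X} x∈X-x refl) =
  s≤s (countIn-mono (p─q⊆p X ⁅ x ⁆) xs)
countIn-remove-< {x = x} {xs = v ∷ xs} {X} (there x∈xs) x∈X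
  with lookup (X - x) v in v∈X-x | lookup X v in v∈X
... | true | true = s≤s (countIn-remove-< x∈xs x∈X)
... | true | false = contradiction (trans (sym (lookup-⊆ (p─q⊆p X ⁅ x ⁆) v∈X-x)) v∈X) λ ()
... | false | true = m≤n⇒m≤1+n (countIn-remove-< x∈xs x∈X)
... | false | false = countIn-remove-< x∈xs x∈X

3≤countIn : ∀ {a b c} → a ≢ b → b ≢ c → a ≢ c → a ∈ᴸ xs → b ∈ᴸ xs → c ∈ᴸ xs →
  a ∈ X → b ∈ X → c ∈ X → 3 ≤ countIn X xs
3≤countIn {xs = xs} {X} {a} {b} {c} a≢b b≢c a≢c a∈xs b∈xs c∈xs a∈X b∈X c∈X = begin
  3                          ≤⟨ s≤s (s≤s (s≤s z≤n)) ⟩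
  suc (suc (suc (countIn (X - a - b - c) xs)))  ≤⟨ s≤s (s≤s (countIn-remove-< c∈xs c∈X-a-b)) ⟩
  suc (suc (countIn (X - a - b) xs))            ≤⟨ s≤s (countIn-remove-< b∈xs b∈X-a) ⟩
  suc (countIn (X - a) xs)                      ≤⟨ countIn-remove-< a∈xs a∈X ⟩
  countIn X xs                                  ∎
  where
  open ≤-Reasoning
  b∈X-a : b ∈ X - a
  b∈X-a = x∈p∧x≢y⇒x∈p-y b∈X (a≢b ∘ sym)
  c∈X-a-b : c ∈ X - a - b
  c∈X-a-b = x∈p∧x≢y⇒x∈p-y (x∈p∧x≢y⇒x∈p-y c∈X (a≢c ∘ sym)) (b≢c ∘ sym)

-- Walks

infixr 5 _++ʷ_
infixl 5 _∷ʳʷ_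

_++ʷ_ : Walk R x y k → Walk R y z l → Walk R x z (k + l)
nil ++ʷ q = q
cons r p ++ʷ q = cons r (p ++ʷ q)

_∷ʳʷ_ : Walk R x y k → R y z → Walk R x z (suc k)
nil ∷ʳʷ r = cons r nil
cons r′ p ∷ʳʷ r = cons r′ (p ∷ʳʷ r)

reverseʷ : Symmetric R → Walk R x y k → Walk R y x k
reverseʷ sym-R nil = nil
reverseʷ sym-R (cons r p) = reverseʷ sym-R p ∷ʳʷ sym-R r

mapʷ : {S : Rel n} → (∀ {x y} → R x y → S x y) → Walk R x y k → Walk S x y k
mapʷ f nil = nil
mapʷ f (cons r p) = cons (f r) (mapʷ f p)

walk-length-0 : Walk R x y 0 → x ≡ y
walk-length-0 nil = refl

start∈verts : (p : Walk R x y k) → x ∈ᴸ verts p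
start∈verts nil = here refl
start∈verts (cons _ _) = here refl

end∈verts : (p : Walk R x y k) → y ∈ᴸ verts p
end∈verts nil = here refl
end∈verts (cons _ p) = there (end∈verts p)

∈-++ʷ⁺ˡ : (p : Walk R x y k) {q : Walk R y z l} → v ∈ᴸ verts p → v ∈ᴸ verts (p ++ʷ q)
∈-++ʷ⁺ˡ nil {q} (here refl) = start∈verts q
∈-++ʷ⁺ˡ (cons _ p) (here refl) = here refl
∈-++ʷ⁺ˡ (cons _ p) (there v∈p) = there (∈-++ʷ⁺ˡ p v∈p)

∈-++ʷ⁺ʳ : (p : Walk R x y k) {q : Walk R y z l} → v ∈ᴸ verts q → v ∈ᴸ verts (p ++ʷ q)
∈-++ʷ⁺ʳ nil v∈q = v∈q
∈-++ʷ⁺ʳ (cons _ p) v∈q = there (∈-++ʷ⁺ʳ p v∈q)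

∈-++ʷ⁻ : (p : Walk R x y k) {q : Walk R y z l} → v ∈ᴸ verts (p ++ʷ q) → v ∈ᴸ verts p ⊎ v ∈ᴸ verts q
∈-++ʷ⁻ nil v∈q = inj₂ v∈q
∈-++ʷ⁻ (cons _ p) (here refl) = inj₁ (here refl)
∈-++ʷ⁻ (cons _ p) (there v∈) = map₁ there (∈-++ʷ⁻ p v∈)

verts-∷ʳʷ : (p : Walk R x y k) (r : R y z) → verts (p ∷ʳʷ r) ≡ verts p ∷ʳ z
verts-∷ʳʷ nil r = refl
verts-∷ʳʷ (cons _ p) r = cong (_ ∷_) (verts-∷ʳʷ p r)

∈-∷ʳʷ⁻ : (p : Walk R x y k) (r : R y z) → v ∈ᴸ verts (p ∷ʳʷ r) → v ∈ᴸ verts p ⊎ v ≡ z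
∈-∷ʳʷ⁻ p r v∈ with ∈-++⁻ (verts p) (subst (_ ∈ᴸ_) (verts-∷ʳʷ p r) v∈)
... | inj₁ v∈p = inj₁ v∈p
... | inj₂ (here v≡z) = inj₂ v≡z

verts-reverseʷ : (sym-R : Symmetric R) (p : Walk R x y k) → verts (reverseʷ sym-R p) ≡ reverse (verts p)
verts-reverseʷ sym-R nil = refl
verts-reverseʷ sym-R (cons {x = x} r p) = begin
  verts (reverseʷ sym-R p ∷ʳʷ sym-R r)  ≡⟨ verts-∷ʳʷ (reverseʷ sym-R p) (sym-R r) ⟩
  verts (reverseʷ sym-R p) ∷ʳ x         ≡⟨ cong (_∷ʳ x) (verts-reverseʷ sym-R p) ⟩
  reverse (verts p) ∷ʳ x                ≡⟨ unfold-reverse x (verts p) ⟨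
  reverse (x ∷ verts p)                 ∎
  where open ≡-Reasoning

∈-reverseʷ⁻ : (sym-R : Symmetric R) (p : Walk R x y k) → v ∈ᴸ verts (reverseʷ sym-R p) → v ∈ᴸ verts p
∈-reverseʷ⁻ sym-R p v∈ = reverse⁻ (subst (_ ∈ᴸ_) (verts-reverseʷ sym-R p) v∈)

verts-mapʷ : {S : Rel n} (f : ∀ {x y} → R x y → S x y) (p : Walk R x y k) → verts (mapʷ f p) ≡ verts p
verts-mapʷ f nil = refl
verts-mapʷ f (cons r p) = cong (_ ∷_) (verts-mapʷ f p)

∈-mapʷ⁻ : {S : Rel n} (f : ∀ {x y} → R x y → S x y) (p : Walk R x y k) →
  v ∈ᴸ verts (mapʷ f p) → v ∈ᴸ verts p
∈-mapʷ⁻ f p = subst (_ ∈ᴸ_) (verts-mapʷ f p)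

toInduced : {P : Fin n → Set} (p : Walk R x y k) → (∀ {v} → v ∈ᴸ verts p → P v) →
  Walk (Induced R P) x y k
toInduced nil _ = nil
toInduced (cons r p) all-P =
  cons (all-P (here refl) , all-P (there (start∈verts p)) , r) (toInduced p (all-P ∘ there))

fromInduced : {P : Fin n → Set} → Walk (Induced R P) x y k → Walk R x y k
fromInduced = mapʷ (proj₂ ∘ proj₂)

∈-induced : {P : Fin n → Set} (p : Walk (Induced R P) x y k) → P x → v ∈ᴸ verts p → P v
∈-induced nil P-x (here refl) = P-x
∈-induced (cons (P-x , _) p) _ (here refl) = P-x
∈-induced (cons (_ , P-y , _) p) _ (there v∈p) = ∈-induced p P-y v∈p

Induced-sym : {P : Fin n → Set} → Symmetric R → Symmetric (Induced R P)
Induced-sym sym-R (P-x , P-y , r) = P-y , P-x , sym-R r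

Induced? : {P : Fin n → Set} → Decidable R → (∀ v → Dec (P v)) → Decidable (Induced R P)
Induced? R? P? x y = P? x ×-dec P? y ×-dec R? x y

connected-via : {P : Fin n → Set} → Symmetric R → (h : Fin n) →
  (∀ t → P t → ∃ (Walk (Induced R P) t h)) → Connected R P
connected-via {R = R} {P = P} sym-R h reach x y P-x P-y =
  _ , proj₂ (reach x P-x) ++ʷ reverseʷ (Induced-sym {R = R} {P = P} sym-R) (proj₂ (reach y P-y))

record Split {n} {R : Rel n} {x z : Fin n} {k} (p : Walk R x z k) (v : Fin n) : Set where
  field
    k₁ k₂ : ℕ
    prefix : Walk R x v k₁
    suffix : Walk R v z k₂
    k₁+k₂≡k : k₁ + k₂ ≡ k
    prefix⊆ : verts prefix ⊆ᴸ verts p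
    suffix⊆ : verts suffix ⊆ᴸ verts p
    prefix∪suffix : ∀ {t} → t ∈ᴸ verts p → t ∈ᴸ verts prefix ⊎ t ∈ᴸ verts suffix

open Split

split : (p : Walk R x z k) → v ∈ᴸ verts p → Split p v
split nil (here refl) = record
  { k₁ = 0 ; k₂ = 0 ; prefix = nil ; suffix = nil ; k₁+k₂≡k = refl
  ; prefix⊆ = id ; suffix⊆ = id ; prefix∪suffix = inj₁ }
split p@(cons _ _) (here refl) = record
  { k₁ = 0 ; k₂ = _ ; prefix = nil ; suffix = p ; k₁+k₂≡k = refl
  ; prefix⊆ = λ { (here refl) → here refl } ; suffix⊆ = id ; prefix∪suffix = inj₂ }
split (cons r p) (there v∈p) = record
  { k₁ = suc (k₁ S) ; k₂ = k₂ S ; prefix = cons r (prefix S) ; suffix = suffix S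
  ; k₁+k₂≡k = cong suc (k₁+k₂≡k S)
  ; prefix⊆ = λ { (here refl) → here refl ; (there t∈) → there (prefix⊆ S t∈) }
  ; suffix⊆ = there ∘ suffix⊆ S
  ; prefix∪suffix = λ { (here refl) → inj₁ (here refl) ; (there t∈) → map₁ there (prefix∪suffix S t∈) } }
  where
  S : Split p _
  S = split p v∈p

-- Distances

dist-0 : IsDist R x y 0 → x ≡ y
dist-0 (p , _) = walk-length-0 p

dist-unique : IsDist R x y k → IsDist R x y l → k ≡ l
dist-unique (p , p-min) (q , q-min) = ≤-antisym (p-min _ q) (q-min _ p)

dist-sym : Symmetric R → IsDist R x y k → IsDist R y x k
dist-sym sym-R (p , p-min) = reverseʷ sym-R p , λ _ q → p-min _ (reverseʷ sym-R q)

dist-cast : k ≡ l → IsDist R x y k → IsDist R x y l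
dist-cast refl d = d

dist-++ : Walk R x y k → Walk R y z l → IsDist R x z (k + l) → IsDist R x y k × IsDist R y z l
dist-++ {k = k} {l = l} p q (_ , pq-min) =
  (p , λ _ p′ → +-cancelʳ-≤ l k _ (pq-min _ (p′ ++ʷ q))) ,
  (q , λ _ q′ → +-cancelˡ-≤ k l _ (pq-min _ (p ++ʷ q′)))

dist-tail : R x y → Walk R y z k → IsDist R x z (suc k) → IsDist R y z k
dist-tail r p d = proj₂ (dist-++ (cons r nil) p d)

split-dist : {p : Walk R x z k} → IsDist R x z k → (S : Split p v) →
  IsDist R x v (k₁ S) × IsDist R v z (k₂ S)
split-dist d S = dist-++ (prefix S) (suffix S) (dist-cast (sym (k₁+k₂≡k S)) d)

walk-length-pos : Walk R x y k → x ≢ y → 0 < k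
walk-length-pos nil x≢y = contradiction refl x≢y
walk-length-pos (cons _ _) _ = s≤s z≤n

head∉tail : IsDist R x z (suc k) → (r : R x y) (p : Walk R y z k) → x ∉ᴸ verts p
head∉tail {k = k} (_ , d-min) r p x∈p = <⇒≱ (s≤s shorter) (d-min _ (suffix S))
  where
  S : Split p _
  S = split p x∈p
  shorter : k₂ S ≤ k
  shorter = subst (k₂ S ≤_) (k₁+k₂≡k S) (m≤n+m (k₂ S) (k₁ S))

start∉suffix : {p : Walk R x z k} → IsDist R x z k → (S : Split p t) → t ≢ x → x ∉ᴸ verts (suffix S)
start∉suffix {k = k} (_ , d-min) S t≢x x∈suffix = <⇒≱ shorter (d-min _ (suffix S′))
  where
  S′ : Split (suffix S) _
  S′ = split (suffix S) x∈suffix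
  shorter : k₂ S′ < k
  shorter = begin-strict
    k₂ S′          ≤⟨ subst (k₂ S′ ≤_) (k₁+k₂≡k S′) (m≤n+m (k₂ S′) (k₁ S′)) ⟩
    k₂ S           <⟨ m<n+m (k₂ S) (walk-length-pos (prefix S) (t≢x ∘ sym)) ⟩
    k₁ S + k₂ S    ≡⟨ k₁+k₂≡k S ⟩
    k              ∎
    where open ≤-Reasoning

end∉prefix : {p : Walk R x z k} → IsDist R x z k → (S : Split p t) → t ≢ z → z ∉ᴸ verts (prefix S)
end∉prefix {k = k} (_ , d-min) S t≢z z∈prefix = <⇒≱ shorter (d-min _ (prefix S′))
  where
  S′ : Split (prefix S) _
  S′ = split (prefix S) z∈prefix
  shorter : k₁ S′ < k
  shorter = begin-strict
    k₁ S′          ≤⟨ subst (k₁ S′ ≤_) (k₁+k₂≡k S′) (m≤m+n (k₁ S′) (k₂ S′)) ⟩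
    k₁ S           <⟨ m<m+n (k₁ S) (walk-length-pos (suffix S) t≢z) ⟩
    k₁ S + k₂ S    ≡⟨ k₁+k₂≡k S ⟩
    k              ∎
    where open ≤-Reasoning

∈-geodesic⇒∈-interval : IsDist R x z k → (p : Walk R x z k) → t ∈ᴸ verts p → InInterval R x z t
∈-geodesic⇒∈-interval d p t∈p =
  _ , k₁ S , k₂ S , d , proj₁ (split-dist d S) , proj₂ (split-dist d S) , sym (k₁+k₂≡k S)
  where
  S : Split p _
  S = split p t∈p

∈-interval-antisym : Symmetric R → ∀ {u} → InInterval R x u y → InInterval R y u x → x ≡ y
∈-interval-antisym sym-R (a , b , c , d-xu , d-xy , d-yu , a≡b+c)
                         (a′ , b′ , c′ , d-yu′ , d-yx , d-xu′ , a′≡b′+c′) =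
  dist-0 (dist-cast b≡0 d-xy)
  where
  a≡b+b+a : a ≡ b + b + a
  a≡b+b+a = begin
    a              ≡⟨ a≡b+c ⟩
    b + c          ≡⟨ cong (b +_) (dist-unique d-yu d-yu′) ⟩
    b + a′         ≡⟨ cong (b +_) a′≡b′+c′ ⟩
    b + (b′ + c′)  ≡⟨ cong₂ (λ b″ c″ → b + (b″ + c″))
                             (dist-unique d-yx (dist-sym sym-R d-xy)) (dist-unique d-xu′ d-xu) ⟩
    b + (b + a)    ≡⟨ +-assoc b b a ⟨
    b + b + a      ∎
    where open ≡-Reasoning
  b≡0 : b ≡ 0
  b≡0 = m+n≡0⇒m≡0 b (+-cancelʳ-≡ a (b + b) 0 (sym a≡b+b+a))

interval⇒geodesic : InInterval R x z y → ∃[ k ] Σ[ p ∈ Walk R x z k ] IsDist R x z k × y ∈ᴸ verts p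
interval⇒geodesic (_ , _ , _ , d , (p , _) , (q , _) , e) =
  _ , p ++ʷ q , dist-cast e d , ∈-++ʷ⁺ˡ p (end∈verts p)

walk? : Decidable R → ∀ x y k → Dec (Walk R x y k)
walk? R? x y zero = map′ (λ { refl → nil }) walk-length-0 (x ≟ᶠ y)
walk? R? x y (suc k) =
  map′ (λ (_ , r , p) → cons r p) (λ { (cons r p) → _ , r , p })
       (any? λ z → R? x z ×-dec walk? R? z y k)

dist-exists : Decidable R → Walk R x y k → ∃ (IsDist R x y)
dist-exists {R = R} {x = x} {y = y} R? = <-rec (λ k → Walk R x y k → ∃ (IsDist R x y)) shortest _
  where
  shortest : ∀ k → (∀ {j} → j < k → Walk R x y j → ∃ (IsDist R x y)) → Walk R x y k → ∃ (IsDist R x y)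
  shortest k shorter p with anyUpTo? (walk? R? x y) k
  ... | yes (_ , j<k , q) = shorter j<k q
  ... | no none = k , p , λ j q → ≮⇒≥ λ j<k → none (j , j<k , q)

-- General position and colinear sets

no-three-on-geodesic : ∀ {C} → IsGP R C X → (p : Walk R x y k) → IsDist R x y k →
  ∀ {a b c} → a ≢ b → b ≢ c → a ≢ c → a ∈ᴸ verts p → b ∈ᴸ verts p → c ∈ᴸ verts p →
  a ∈ X → b ∈ X → c ∈ X → ⊥
no-three-on-geodesic (_ , gp) p d a≢b b≢c a≢c a∈p b∈p c∈p a∈X b∈X c∈X =
  <⇒≱ (s≤s (3≤countIn a≢b b≢c a≢c a∈p b∈p c∈p a∈X b∈X c∈X)) (s≤s (gp _ _ _ p d))

-- the third condition of IsColinear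
IntervalFree : Rel n → Fin n → Subset n → Set
IntervalFree R u S = ∀ x y → x ∈ S → y ∈ S → x ≢ y → ¬ InInterval R x u y

geodesic-count-⁅⁆≤1 : IsDist R x y k → (p : Walk R x y k) → countIn ⁅ v ⁆ (verts p) ≤ 1
geodesic-count-⁅⁆≤1 {x = x} {v = v} d nil = countIn-∷-≤1 ⁅ v ⁆ x [] (λ _ → refl) z≤n
geodesic-count-⁅⁆≤1 {x = x} {v = v} d (cons r p) =
  countIn-∷-≤1 ⁅ v ⁆ x (verts p) (λ x∈⁅v⁆ → countIn-≡0 λ t∈p t∈⁅v⁆ →
                  head∉tail d r p (subst (_∈ᴸ verts p)
                    (trans (x∈⁅y⁆⇒x≡y v t∈⁅v⁆) (sym (x∈⁅y⁆⇒x≡y v x∈⁅v⁆))) t∈p))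
               (geodesic-count-⁅⁆≤1 (dist-tail r p d) p)

⁅⁆-colinear : ∀ {C u} → v ∈ C → v ≢ u → IsColinear R C u ⁅ v ⁆
⁅⁆-colinear {v = v} v∈C v≢u =
  ((λ t∈⁅v⁆ → subst (_∈ _) (sym (x∈⁅y⁆⇒x≡y v t∈⁅v⁆)) v∈C) ,
   λ _ _ _ p d → m≤n⇒m≤1+n (geodesic-count-⁅⁆≤1 d p)) ,
  (λ u∈⁅v⁆ → v≢u (sym (x∈⁅y⁆⇒x≡y v u∈⁅v⁆))) ,
  λ _ _ x∈⁅v⁆ y∈⁅v⁆ x≢y _ → x≢y (trans (x∈⁅y⁆⇒x≡y v x∈⁅v⁆) (sym (x∈⁅y⁆⇒x≡y v y∈⁅v⁆)))

colinear-count≤1 : ∀ {C u S} → IsColinear R C u S → IsDist R x u k → (p : Walk R x u k) →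
  countIn S (verts p) ≤ 1
colinear-count≤1 {x = x} {S = S} col d nil = countIn-∷-≤1 S x [] (λ _ → refl) z≤n
colinear-count≤1 {x = x} {S = S} col@(_ , _ , no-interval) d (cons r p) =
  countIn-∷-≤1 S x (verts p) (λ x∈S → countIn-≡0 λ t∈p t∈S →
                  no-interval x _ x∈S t∈S (λ { refl → head∉tail d r p t∈p })
                    (∈-geodesic⇒∈-interval d (cons r p) (there t∈p)))
               (colinear-count≤1 col (dist-tail r p d) p)

-- Cycles and blocks

module _ {n : ℕ} (G : Graph n) where

  Adj-sym : Symmetric (Adj G)
  Adj-sym {x} {y} = trans (Graph.sym G y x)

  Adj? : Decidable (Adj G)
  Adj? x y = E G x y Bool.≟ true

  Adj-irrefl : Adj G x y → x ≢ y
  Adj-irrefl {x} x~y refl = contradiction (trans (sym (irrefl G x)) x~y) λ ()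

  AdjAvoiding : Fin n → Rel n
  AdjAvoiding y = Induced (Adj G) (_≢ y)

  -- y and a shortest path P from a to b in G - y span a cycle; P visits no vertex twice, so
  -- removing one vertex of the cycle leaves the rest connected.
  module Cycle {y a b : Fin n} {m : ℕ} (a~y : Adj G a y) (y~b : Adj G y b)
    (geo : IsDist (AdjAvoiding y) a b m) where

    P : Walk (AdjAvoiding y) a b m
    P = proj₁ geo

    P-avoids : t ∈ᴸ verts P → t ≢ y
    P-avoids = ∈-induced P (Adj-irrefl a~y)

    Avoiding-sym : Symmetric (AdjAvoiding y)
    Avoiding-sym = Induced-sym {R = Adj G} {P = _≢ y} Adj-sym

    on-cycle? : ∀ t → Dec (t ≡ y ⊎ t ∈ᴸ verts P)
    on-cycle? t = (t ≟ᶠ y) ⊎-dec (Any.any? (t ≟ᶠ_) (verts P))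

    B : Subset n
    B = decSubset on-cycle?

    ∈B⁻ : t ∈ B → t ≡ y ⊎ t ∈ᴸ verts P
    ∈B⁻ = ∈-decSubset⁻ on-cycle?

    y∈B : y ∈ B
    y∈B = ∈-decSubset⁺ on-cycle? (inj₁ refl)

    P⊆B : t ∈ᴸ verts P → t ∈ B
    P⊆B = ∈-decSubset⁺ on-cycle? ∘ inj₂

    back-to-a : t ∈ᴸ verts P → ∃[ k ] Σ[ w ∈ Walk (AdjAvoiding y) t a k ] verts w ⊆ᴸ verts P
    back-to-a t∈P =
      _ , reverseʷ Avoiding-sym (prefix S) , prefix⊆ S ∘ ∈-reverseʷ⁻ Avoiding-sym (prefix S)
      where
      S : Split P _
      S = split P t∈P

    via-y : {Q : Fin n → Set} {c : Fin n} (w : Walk (AdjAvoiding y) t c k) → Adj G c y →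
      (∀ {s} → s ∈ᴸ verts w → Q s) → Q y → ∃ (Walk (Induced (Adj G) Q) t y)
    via-y w c~y Q-w Q-y = _ , toInduced (fromInduced w ∷ʳʷ c~y) λ s∈ →
      [ Q-w ∘ ∈-mapʷ⁻ _ w , (λ { refl → Q-y }) ] (∈-∷ʳʷ⁻ (fromInduced w) c~y s∈)

    B-connected : Connected (Adj G) (_∈ B)
    B-connected = connected-via Adj-sym y reach
      where
      reach : ∀ t → t ∈ B → ∃ (Walk (Induced (Adj G) (_∈ B)) t y)
      reach t t∈B with ∈B⁻ t∈B
      ... | inj₁ refl = _ , nil
      ... | inj₂ t∈P with back-to-a t∈P
      ...   | _ , w , w⊆P = via-y w a~y (P⊆B ∘ w⊆P) y∈B

    B∖y-connected : Connected (Adj G) (λ s → s ∈ B × s ≢ y)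
    B∖y-connected = connected-via Adj-sym a reach
      where
      reach : ∀ t → t ∈ B × t ≢ y → ∃ (Walk (Induced (Adj G) (λ s → s ∈ B × s ≢ y)) t a)
      reach t (t∈B , t≢y) with ∈B⁻ t∈B
      ... | inj₁ t≡y = contradiction t≡y t≢y
      ... | inj₂ t∈P with back-to-a t∈P
      ...   | _ , w , w⊆P = _ , toInduced (fromInduced w) λ s∈ →
                let s∈P = w⊆P (∈-mapʷ⁻ _ w s∈) in P⊆B s∈P , P-avoids s∈P

    B∖v-connected : v ∈ᴸ verts P → Connected (Adj G) (λ s → s ∈ B × s ≢ v)
    B∖v-connected {v} v∈P = connected-via Adj-sym y reach
      where
      Sv : Split P v
      Sv = split P v∈P
      y≢v : y ≢ v
      y≢v = P-avoids v∈P ∘ sym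
      reach : ∀ t → t ∈ B × t ≢ v → ∃ (Walk (Induced (Adj G) (λ s → s ∈ B × s ≢ v)) t y)
      reach t (t∈B , t≢v) with ∈B⁻ t∈B
      ... | inj₁ refl = _ , nil
      ... | inj₂ t∈P with prefix∪suffix Sv t∈P
      ...   | inj₁ t∈prefix = via-y (reverseʷ Avoiding-sym (prefix St)) a~y within (y∈B , y≢v)
        where
        St : Split (prefix Sv) t
        St = split (prefix Sv) t∈prefix
        within : ∀ {s} → s ∈ᴸ verts (reverseʷ Avoiding-sym (prefix St)) → s ∈ B × s ≢ v
        within s∈ = P⊆B (prefix⊆ Sv (prefix⊆ St s∈St)) ,
                    λ { refl → end∉prefix (proj₁ (split-dist geo Sv)) St t≢v s∈St }
          where
          s∈St : _ ∈ᴸ verts (prefix St)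
          s∈St = ∈-reverseʷ⁻ Avoiding-sym (prefix St) s∈
      ...   | inj₂ t∈suffix = via-y (suffix St) (Adj-sym y~b) within (y∈B , y≢v)
        where
        St : Split (suffix Sv) t
        St = split (suffix Sv) t∈suffix
        within : ∀ {s} → s ∈ᴸ verts (suffix St) → s ∈ B × s ≢ v
        within s∈ = P⊆B (suffix⊆ Sv (suffix⊆ St s∈)) ,
                    λ { refl → start∉suffix (proj₂ (split-dist geo Sv)) St t≢v s∈ }

    B-biconnected : IsBiconnected G B
    B-biconnected = two-elements⇒2≤∣p∣ a∈B y∈B (Adj-irrefl a~y) , B-connected ,
      λ v v∈B → [ (λ { refl → B∖y-connected }) , B∖v-connected ] (∈B⁻ v∈B)
      where
      a∈B : a ∈ B
      a∈B = P⊆B (start∈verts P)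

  maximal-if-no-larger : ∀ {B} → (∀ B′ → B ⊆ B′ → IsBiconnected G B′ → ¬ (∣ B ∣ < ∣ B′ ∣)) →
    ∀ B′ → B ⊆ B′ → IsBiconnected G B′ → B′ ⊆ B
  maximal-if-no-larger {B} no-larger B′ B⊆B′ B′-bc {v} v∈B′ with v ∈? B
  ... | yes v∈B = v∈B
  ... | no v∉B = ⊥-elim (no-larger B′ B⊆B′ B′-bc (p⊂q⇒∣p∣<∣q∣ (B⊆B′ , v , v∈B′ , v∉B)))

  biconnected⇒¬¬block : ∀ {B} → IsBiconnected G B → ¬ ¬ (∃[ B′ ] IsBlock G B′ × B ⊆ B′)
  biconnected⇒¬¬block {B} = extend n (m≤n+m n ∣ B ∣)
    where
    extend : ∀ fuel {B} → n ≤ ∣ B ∣ + fuel → IsBiconnected G B → ¬ ¬ (∃[ B′ ] IsBlock G B′ × B ⊆ B′)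
    extend zero {B} n≤∣B∣+0 B-bc no-block =
      no-block (B , (B-bc , maximal-if-no-larger λ B′ _ _ ∣B∣<∣B′∣ →
        <⇒≱ ∣B∣<∣B′∣ (≤-trans (∣p∣≤n B′) (subst (n ≤_) (+-identityʳ ∣ B ∣) n≤∣B∣+0))) , id)
    extend (suc fuel) {B} n≤∣B∣+1+fuel B-bc no-block =
      no-block (B , (B-bc , maximal-if-no-larger λ B′ B⊆B′ B′-bc ∣B∣<∣B′∣ →
        extend fuel
          (≤-trans n≤∣B∣+1+fuel (≤-trans (≤-reflexive (+-suc ∣ B ∣ fuel)) (+-monoˡ-≤ fuel ∣B∣<∣B′∣)))
          B′-bc λ (B″ , B″-block , B′⊆B″) → no-block (B″ , B″-block , B′⊆B″ ∘ B⊆B′)) , id)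

  module _ (block-graph : IsBlockGraph G) where

    biconnected⇒complete : ∀ {B} → IsBiconnected G B → x ∈ B → y ∈ B → x ≢ y → Adj G x y
    biconnected⇒complete {x = x} {y} B-bc x∈B y∈B x≢y = decidable-stable (Adj? x y) λ ¬x~y →
      biconnected⇒¬¬block B-bc λ (B′ , B′-block , B⊆B′) →
        ¬x~y (block-graph B′ B′-block x y (B⊆B′ x∈B) (B⊆B′ y∈B) x≢y)

    -- The neighbours a, a′ of y towards x and u are at distance 2 (the geodesic through them is
    -- shortest), but a walk x → u avoiding y closes a cycle through a, y, a′, so a ~ a′.
    bypass⇒⊥ : ∀ {u k₁ k₂} → IsDist (Adj G) x u (k₁ + k₂) →
      IsDist (Adj G) y x k₁ → IsDist (Adj G) y u k₂ → y ≢ x → y ≢ u →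
      (W : Walk (Adj G) x u k) → y ∉ᴸ verts W → ⊥
    bypass⇒⊥ _ (nil , _) _ y≢x _ _ _ = y≢x refl
    bypass⇒⊥ _ _ (nil , _) _ y≢u _ _ = y≢u refl
    bypass⇒⊥ {y = y} {k₁ = suc k₁} {suc k₂} (_ , xu-min)
      d-yx@(cons {y = a} y~a p , _) d-yu@(cons {y = a′} y~a′ q , _) _ _ W y∉W =
      ¬a~a′ (biconnected⇒complete C.B-biconnected (C.P⊆B (start∈verts C.P)) (C.P⊆B (end∈verts C.P)) a≢a′)
      where
      V : Walk (Adj G) a a′ _
      V = p ++ʷ W ++ʷ reverseʷ Adj-sym q
      V-avoids : ∀ {s} → s ∈ᴸ verts V → s ≢ y
      V-avoids s∈V refl with ∈-++ʷ⁻ p s∈V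
      ... | inj₁ y∈p = head∉tail d-yx y~a p y∈p
      ... | inj₂ y∈W++q with ∈-++ʷ⁻ W y∈W++q
      ...   | inj₁ y∈W = y∉W y∈W
      ...   | inj₂ y∈q = head∉tail d-yu y~a′ q (∈-reverseʷ⁻ Adj-sym q y∈q)
      module C = Cycle (Adj-sym y~a) y~a′
        (proj₂ (dist-exists (Induced? Adj? (λ s → ¬? (s ≟ᶠ y))) (toInduced V V-avoids)))
      far : ∀ {j} → Walk (Adj G) a a′ j → 2 ≤ j
      far {j} w = +-cancelʳ-≤ k₂ 2 j (+-cancelˡ-≤ k₁ (2 + k₂) (j + k₂)
        (subst (_≤ k₁ + (j + k₂)) (sym (+-suc k₁ (suc k₂))) (xu-min _ (reverseʷ Adj-sym p ++ʷ w ++ʷ q))))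
      a≢a′ : a ≢ a′
      a≢a′ refl = contradiction (far nil) λ ()
      ¬a~a′ : ¬ Adj G a a′
      ¬a~a′ a~a′ = contradiction (far (cons a~a′ nil)) λ { (s≤s ()) }

    interval-cut-vertex : ∀ {u} → InInterval (Adj G) x u y → y ≢ x → y ≢ u →
      (W : Walk (Adj G) x u k) → y ∈ᴸ verts W
    interval-cut-vertex {y = y} (_ , _ , _ , d-xu , d-xy , d-yu , e) y≢x y≢u W
      with Any.any? (y ≟ᶠ_) (verts W)
    ... | yes y∈W = y∈W
    ... | no y∉W = ⊥-elim (bypass⇒⊥ (dist-cast e d-xu) (dist-sym Adj-sym d-xy) d-yu y≢x y≢u W y∉W)

    module _ (connected : ConnectedGraph G) {X : Subset n} (X-gp : IsGP (Adj G) ⊤ X) where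

      geodesic : ∀ x y → ∃ (IsDist (Adj G) x y)
      geodesic x y = dist-exists Adj? (fromInduced (proj₂ (connected x y tt tt)))

      module _ {u : Fin n} (u∉X : u ∉ X) where

        private
          ≢u : v ∈ X → v ≢ u
          ≢u v∈X refl = u∉X v∈X

        interval-chain⇒⊥ : ∀ {x x′ y} → InInterval (Adj G) x u y → InInterval (Adj G) x′ u x →
          x′ ≢ x → x ≢ y → x′ ∈ X → x ∈ X → y ∈ X → ⊥
        interval-chain⇒⊥ {x} {x′} {y} I₁ I₂@(_ , _ , _ , d , (p , _) , (q , _) , e) x′≢x x≢y x′∈X x∈X y∈X
          with x′ ≟ᶠ y
        ... | yes refl = x≢y (∈-interval-antisym Adj-sym I₁ I₂)
        ... | no x′≢y = no-three-on-geodesic X-gp (p ++ʷ q) (dist-cast e d) x′≢x x≢y x′≢y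
                          (start∈verts (p ++ʷ q)) (∈-++ʷ⁺ˡ p (end∈verts p))
                          (∈-++ʷ⁺ʳ p (interval-cut-vertex I₁ (x≢y ∘ sym) (≢u y∈X) q)) x′∈X x∈X y∈X

        interval-ends-agree : ∀ {x₁ y₁ x₂ y₂} → x₁ ∈ X → y₁ ∈ X → x₂ ∈ X → y₂ ∈ X → x₁ ≢ y₁ → x₂ ≢ y₂ →
          InInterval (Adj G) x₁ u y₁ → InInterval (Adj G) x₂ u y₂ → y₁ ≡ y₂
        interval-ends-agree {x₁} {y₁} {x₂} {y₂} x₁∈X y₁∈X x₂∈X y₂∈X x₁≢y₁ x₂≢y₂ I₁ I₂ with y₁ ≟ᶠ y₂
        ... | yes y₁≡y₂ = y₁≡y₂
        ... | no y₁≢y₂ with interval⇒geodesic I₁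
        ...   | _ , g₁ , g₁-geo , y₁∈g₁ = ⊥-elim (y₂-placed (x₁ ≟ᶠ x₂) (y₂ ≟ᶠ x₁))
          where
          -- y₂ separates x₂ from u, so it lies on x₂ → x₁ followed by g₁ : x₁ → y₁ → u, and either
          -- piece then carries three points of X.
          y₂-on : (W : Walk (Adj G) x₂ u k) → y₂ ∈ᴸ verts W
          y₂-on = interval-cut-vertex I₂ (x₂≢y₂ ∘ sym) (≢u y₂∈X)
          on-g₁ : y₂ ∈ᴸ verts g₁ → y₂ ≢ x₁ → ⊥
          on-g₁ y₂∈g₁ y₂≢x₁ = no-three-on-geodesic X-gp g₁ g₁-geo x₁≢y₁ y₁≢y₂ (y₂≢x₁ ∘ sym)
            (start∈verts g₁) y₁∈g₁ y₂∈g₁ x₁∈X y₁∈X y₂∈X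
          y₂-placed : Dec (x₁ ≡ x₂) → Dec (y₂ ≡ x₁) → ⊥
          y₂-placed (yes refl) _ = on-g₁ (y₂-on g₁) (x₂≢y₂ ∘ sym)
          y₂-placed (no x₁≢x₂) (yes refl) = interval-chain⇒⊥ I₁ I₂ (x₁≢x₂ ∘ sym) x₁≢y₁ x₂∈X x₁∈X y₁∈X
          y₂-placed (no x₁≢x₂) (no y₂≢x₁) with geodesic x₂ x₁
          ... | _ , h-geo@(h , _) with ∈-++ʷ⁻ h (y₂-on (h ++ʷ g₁))
          ...   | inj₁ y₂∈h = no-three-on-geodesic X-gp h h-geo x₂≢y₂ y₂≢x₁ (x₁≢x₂ ∘ sym)
                                (start∈verts h) y₂∈h (end∈verts h) x₂∈X y₂∈X x₁∈X
          ...   | inj₂ y₂∈g₁ = on-g₁ y₂∈g₁ y₂≢x₁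

      -- y₀ is u if u ∈ X, and otherwise the common end y of all pairs x, y with y ∈ I[x,u]; the
      -- statement is double negated because whether such a pair exists is decided classically.
      removable-vertex : ∀ u → ¬ ¬ (∃[ y₀ ] u ∉ X - y₀ × IntervalFree (Adj G) u (X - y₀))
      removable-vertex u with u ∈? X
      ... | yes u∈X = λ none → none (u , (λ u∈X-u → x∈p-y⇒x≢y u∈X-u refl) , through-u)
        where
        through-u : IntervalFree (Adj G) u (X - u)
        through-u x y x∈ y∈ x≢y I with interval⇒geodesic I
        ... | _ , g , g-geo , y∈g = no-three-on-geodesic X-gp g g-geo x≢y (x∈p-y⇒x≢y y∈) (x∈p-y⇒x≢y x∈)
                                      (start∈verts g) y∈g (end∈verts g) (x∈p-y⇒x∈p x∈) (x∈p-y⇒x∈p y∈) u∈X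
      ... | no u∉X = λ none → ¬¬-excluded-middle (none ∘ remove-common-end)
        where
        remove-common-end : Dec (∃[ x ] ∃[ y ] x ∈ X × y ∈ X × x ≢ y × InInterval (Adj G) x u y) →
          ∃[ y₀ ] u ∉ X - y₀ × IntervalFree (Adj G) u (X - y₀)
        remove-common-end (yes (x₀ , y₀ , x₀∈X , y₀∈X , x₀≢y₀ , I₀)) =
          y₀ , u∉X ∘ x∈p-y⇒x∈p , λ x y x∈ y∈ x≢y I →
            x∈p-y⇒x≢y y∈ (sym (interval-ends-agree u∉X x₀∈X y₀∈X (x∈p-y⇒x∈p x∈) (x∈p-y⇒x∈p y∈)
                                x₀≢y₀ x≢y I₀ I))
        remove-common-end (no no-pair) =
          u , u∉X ∘ x∈p-y⇒x∈p , λ x y x∈ y∈ x≢y I →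
            no-pair (x , y , x∈p-y⇒x∈p x∈ , x∈p-y⇒x∈p y∈ , x≢y , I)

-- The two sides of a bridge

module Bridge {n : ℕ} (G : Graph n) (connected : ConnectedGraph G) (u₁ u₂ : Fin n)
  (bridge : IsBridge G u₁ u₂) (C₁ C₂ : Subset n)
  (C₁-component : IsComponentOf (AdjMinus G u₁ u₂) u₁ C₁)
  (C₂-component : IsComponentOf (AdjMinus G u₁ u₂) u₂ C₂) where

  data Side : Set where
    side₁ side₂ : Side

  data Opposite : Side → Side → Set where
    o₁₂ : Opposite side₁ side₂
    o₂₁ : Opposite side₂ side₁

  private variable
    i j j′ : Side

  opposite : ∀ i → ∃ (Opposite i)
  opposite side₁ = side₂ , o₁₂
  opposite side₂ = side₁ , o₂₁

  Opposite-unique : Opposite i j → Opposite i j′ → j ≡ j′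
  Opposite-unique o₁₂ o₁₂ = refl
  Opposite-unique o₂₁ o₂₁ = refl

  Opposite-sym : Opposite i j → Opposite j i
  Opposite-sym o₁₂ = o₂₁
  Opposite-sym o₂₁ = o₁₂

  Opposite-involutive : Opposite i j → Opposite j j′ → i ≡ j′
  Opposite-involutive o₁₂ o₂₁ = refl
  Opposite-involutive o₂₁ o₁₂ = refl

  G-e : Rel n
  G-e = AdjMinus G u₁ u₂

  u : Side → Fin n
  u side₁ = u₁
  u side₂ = u₂

  C : Side → Subset n
  C side₁ = C₁
  C side₂ = C₂

  Gᵢ : Side → Rel n
  Gᵢ i = Induced G-e (_∈ C i)

  C-component : ∀ i → IsComponentOf G-e (u i) (C i)
  C-component side₁ = C₁-component
  C-component side₂ = C₂-component

  G-e-sym : Symmetric G-e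
  G-e-sym (x~y , not-bridge) = Adj-sym G x~y , λ
    { (inj₁ (y≡u₁ , x≡u₂)) → not-bridge (inj₂ (x≡u₂ , y≡u₁))
    ; (inj₂ (y≡u₂ , x≡u₁)) → not-bridge (inj₁ (x≡u₁ , y≡u₂)) }

  G-e? : Decidable G-e
  G-e? x y = Adj? G x y ×-dec ¬? ((x ≟ᶠ u₁ ×-dec y ≟ᶠ u₂) ⊎-dec (x ≟ᶠ u₂ ×-dec y ≟ᶠ u₁))

  Gᵢ? : ∀ i → Decidable (Gᵢ i)
  Gᵢ? i = Induced? G-e? (_∈? C i)

  Gᵢ-sym : Symmetric (Gᵢ i)
  Gᵢ-sym {i} = Induced-sym {R = G-e} {P = _∈ C i} G-e-sym

  bridge-edge : Opposite i j → Adj G (u i) (u j)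
  bridge-edge o₁₂ = proj₁ bridge
  bridge-edge o₂₁ = Adj-sym G (proj₁ bridge)

  edge-kind : Adj G x y → G-e x y ⊎ ∃[ i ] ∃[ j ] Opposite i j × x ≡ u i × y ≡ u j
  edge-kind {x} {y} x~y with (x ≟ᶠ u₁ ×-dec y ≟ᶠ u₂) ⊎-dec (x ≟ᶠ u₂ ×-dec y ≟ᶠ u₁)
  ... | no not-bridge = inj₁ (x~y , not-bridge)
  ... | yes (inj₁ (x≡u₁ , y≡u₂)) = inj₂ (side₁ , side₂ , o₁₂ , x≡u₁ , y≡u₂)
  ... | yes (inj₂ (x≡u₂ , y≡u₁)) = inj₂ (side₂ , side₁ , o₂₁ , x≡u₂ , y≡u₁)

  edge-at-u : Opposite i j → Adj G (u i) v → v ≢ u j → G-e (u i) v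
  edge-at-u o₁₂ u~v v≢u = u~v , λ
    { (inj₁ (_ , v≡u₂)) → v≢u v≡u₂
    ; (inj₂ (u₁≡u₂ , _)) → Adj-irrefl G (proj₁ bridge) u₁≡u₂ }
  edge-at-u o₂₁ u~v v≢u = u~v , λ
    { (inj₁ (u₂≡u₁ , _)) → Adj-irrefl G (proj₁ bridge) (sym u₂≡u₁)
    ; (inj₂ (_ , v≡u₁)) → v≢u v≡u₁ }

  u∈C : ∀ i → u i ∈ C i
  u∈C i = proj₂ (C-component i (u i)) (0 , nil)

  C-closed : v ∈ C i → G-e v x → x ∈ C i
  C-closed {i = i} {x = x} v∈C v~x with proj₁ (C-component i _) v∈C
  ... | _ , p = proj₂ (C-component i x) (_ , p ++ʷ cons v~x nil)

  C-disjoint : Opposite i j → v ∈ C i → v ∉ C j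
  C-disjoint o₁₂ v∈C₁ v∈C₂ with proj₁ (C₁-component _) v∈C₁ | proj₁ (C₂-component _) v∈C₂
  ... | _ , p | _ , q = proj₂ bridge (_ , p ++ʷ reverseʷ G-e-sym q)
  C-disjoint o₂₁ v∈C₂ v∈C₁ = C-disjoint o₁₂ v∈C₁ v∈C₂

  u-side : ∀ i j → u i ∈ C j → i ≡ j
  u-side side₁ side₁ _ = refl
  u-side side₂ side₂ _ = refl
  u-side side₁ side₂ u₁∈C₂ = ⊥-elim (C-disjoint o₁₂ (u∈C side₁) u₁∈C₂)
  u-side side₂ side₁ u₂∈C₁ = ⊥-elim (C-disjoint o₂₁ (u∈C side₂) u₂∈C₁)

  walk-side : Walk (Adj G) x v k → x ∈ C i → ∃[ j ] v ∈ C j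
  walk-side nil x∈C = _ , x∈C
  walk-side (cons x~y p) x∈C with edge-kind x~y
  ... | inj₁ x~y-e = walk-side p (C-closed x∈C x~y-e)
  ... | inj₂ (_ , j , _ , _ , refl) = walk-side p (u∈C j)

  C-cover : Opposite i j → ∀ v → v ∈ C i ⊎ v ∈ C j
  C-cover o v with walk-side (fromInduced (proj₂ (connected u₁ v tt tt))) (u∈C side₁)
  C-cover o₁₂ v | side₁ , v∈C = inj₁ v∈C
  C-cover o₁₂ v | side₂ , v∈C = inj₂ v∈C
  C-cover o₂₁ v | side₁ , v∈C = inj₂ v∈C
  C-cover o₂₁ v | side₂ , v∈C = inj₁ v∈C

  lift : Walk (Gᵢ i) x y k → Walk (Adj G) x y k
  lift = mapʷ (proj₁ ∘ proj₂ ∘ proj₂)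

  Gᵢ-end : x ∈ C i → Walk (Gᵢ i) x y k → y ∈ C i
  Gᵢ-end x∈C p = ∈-induced p x∈C (end∈verts p)

  Gᵢ-walk : v ∈ C i → Walk G-e v y k → Walk (Gᵢ i) v y k
  Gᵢ-walk v∈C p = toInduced p (stays v∈C p)
    where
    stays : v ∈ C i → (p : Walk G-e v y k) → t ∈ᴸ verts p → t ∈ C i
    stays v∈C nil (here refl) = v∈C
    stays v∈C (cons _ _) (here refl) = v∈C
    stays v∈C (cons v~w p) (there t∈p) = stays (C-closed v∈C v~w) p t∈p

  dist-to-u : v ∈ C i → ∃ (IsDist (Gᵢ i) v (u i))
  dist-to-u {i = i} v∈C =
    dist-exists (Gᵢ? i) (reverseʷ Gᵢ-sym (Gᵢ-walk (u∈C i) (proj₂ (proj₁ (C-component i _) v∈C))))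

  dist-from-u : v ∈ C i → ∃ (IsDist (Gᵢ i) (u i) v)
  dist-from-u v∈C = _ , dist-sym Gᵢ-sym (proj₂ (dist-to-u v∈C))

  geodesic-Gᵢ : IsDist (Adj G) x y k → Walk (Gᵢ i) x y k → IsDist (Gᵢ i) x y k
  geodesic-Gᵢ (_ , min) p = p , λ _ q → min _ (lift q)

  data Decomposition (i : Side) {x z k} (w : Walk (Adj G) x z k) : Set where
    within : (p : Walk (Gᵢ i) x z k) → verts p ≡ verts w → Decomposition i w
    across : ∀ {j k₁ k₂} → Opposite i j → (p : Walk (Gᵢ i) x (u i) k₁) (q : Walk (Gᵢ j) (u j) z k₂) →
      suc (k₁ + k₂) ≡ k → verts w ≡ verts p ++ verts q → Decomposition i w

  -- a geodesic crosses the bridge at most once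
  decompose : IsDist (Adj G) x z k → (w : Walk (Adj G) x z k) → x ∈ C i → Decomposition i w
  decompose d nil _ = within nil refl
  decompose d (cons x~y w) x∈C with edge-kind x~y
  ... | inj₁ x~y-e with decompose (dist-tail x~y w d) w (C-closed x∈C x~y-e)
  ...   | within p eq = within (cons (x∈C , C-closed x∈C x~y-e , x~y-e) p) (cong (_ ∷_) eq)
  ...   | across o p q len eq =
          across o (cons (x∈C , C-closed x∈C x~y-e , x~y-e) p) q (cong suc len) (cong (_ ∷_) eq)
  decompose {i = i} d (cons x~y w) x∈C | inj₂ (i′ , j , o , refl , refl) with u-side i′ i x∈C
  ... | refl with decompose (dist-tail x~y w d) w (u∈C j)
  ...   | within q eq = across o nil q refl (cong (u i ∷_) (sym eq))
  ...   | across {k₁ = k₁} {k₂} o′ p q len eq with Opposite-involutive o o′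
  ...     | refl = contradiction (proj₂ d _ (lift q)) (<⇒≱ (s≤s (begin
                  k₂                ≤⟨ m≤n+m k₂ k₁ ⟩
                  k₁ + k₂           ≤⟨ n≤1+n _ ⟩
                  suc (k₁ + k₂)     ≡⟨ len ⟩
                  _                 ∎)))
    where open ≤-Reasoning

  dist-Gᵢ⇒dist : IsDist (Gᵢ i) x y k → IsDist (Adj G) x y k
  dist-Gᵢ⇒dist (nil , _) = nil , λ _ _ → z≤n
  dist-Gᵢ⇒dist {x = x} {y = y} {k = k} (p@(cons (x∈C , _) _) , p-min) = lift p , shortest
    where
    shortest : ∀ m → Walk (Adj G) x y m → k ≤ m
    shortest m w with dist-exists (Adj? G) w
    ... | _ , g-geo@(g , g-min) with decompose g-geo g x∈C
    ...   | within q _ = ≤-trans (p-min _ q) (g-min m w)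
    ...   | across o _ q _ _ = ⊥-elim (C-disjoint o (Gᵢ-end x∈C p) (Gᵢ-end (u∈C _) q))

  dist-across : Opposite i j → x ∈ C i → IsDist (Gᵢ i) x (u i) k → IsDist (Gᵢ j) (u j) z l →
    IsDist (Adj G) x z (k + suc l)
  dist-across {x = x} {k = k} {z = z} {l = l} o x∈C (p , p-min) (q , q-min) =
    lift p ++ʷ cons (bridge-edge o) (lift q) , shortest
    where
    shortest : ∀ m → Walk (Adj G) x z m → k + suc l ≤ m
    shortest m w with dist-exists (Adj? G) w
    ... | d , g-geo@(g , g-min) with decompose g-geo g x∈C
    ...   | within q′ _ = ⊥-elim (C-disjoint o (Gᵢ-end x∈C q′) (Gᵢ-end (u∈C _) q))
    ...   | across {k₁ = k′} {k₂ = l′} o′ p′ q′ len _ with Opposite-unique o o′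
    ...     | refl = begin
      k + suc l        ≡⟨ +-suc k l ⟩
      suc (k + l)      ≤⟨ s≤s (+-mono-≤ (p-min _ p′) (q-min _ q′)) ⟩
      suc (k′ + l′)    ≡⟨ len ⟩
      d                ≤⟨ g-min m w ⟩
      m                ∎
      where open ≤-Reasoning

  across-geodesics : IsDist (Adj G) x z m → Opposite i j →
    (p : Walk (Gᵢ i) x (u i) k) (q : Walk (Gᵢ j) (u j) z l) → suc (k + l) ≡ m →
    IsDist (Gᵢ i) x (u i) k × IsDist (Gᵢ j) (u j) z l
  across-geodesics {k = k} {l = l} d o p q len =
    geodesic-Gᵢ (proj₁ parts) p , geodesic-Gᵢ (dist-tail (bridge-edge o) (lift q) (proj₂ parts)) q
    where
    parts : IsDist (Adj G) _ _ k × IsDist (Adj G) _ _ (suc l)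
    parts = dist-++ (lift p) (cons (bridge-edge o) (lift q))
              (dist-cast (trans (sym len) (sym (+-suc k l))) d)

  side-of : ∀ v → ∃[ i ] ∃[ j ] Opposite i j × v ∈ C i
  side-of v with C-cover o₁₂ v
  ... | inj₁ v∈C₁ = side₁ , side₂ , o₁₂ , v∈C₁
  ... | inj₂ v∈C₂ = side₂ , side₁ , o₂₁ , v∈C₂

  module _ (S : Side → Subset n) (S-colinear : ∀ i → IsColinear (Gᵢ i) (C i) (u i) (S i)) where

    private
      S⊆C : ∀ i → S i ⊆ C i
      S⊆C i = proj₁ (proj₁ (S-colinear i))

      countIn-sides : Opposite i j → ∀ xs → countIn (S j) xs ≡ 0 →
        countIn (S side₁) xs + countIn (S side₂) xs ≡ countIn (S i) xs
      countIn-sides o₁₂ xs other≡0 = trans (cong (countIn (S side₁) xs +_) other≡0) (+-identityʳ _)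
      countIn-sides o₂₁ xs other≡0 = cong (_+ countIn (S side₂) xs) other≡0

      countIn-one-side : Opposite i j → (p : Walk (Gᵢ i) x y k) → x ∈ C i →
        countIn (S side₁ ∪ S side₂) (verts p) ≤ countIn (S i) (verts p)
      countIn-one-side {j = j} o p x∈C = ≤-trans (countIn-∪ (S side₁) (S side₂) (verts p))
        (≤-reflexive (countIn-sides o (verts p) (countIn-≡0 λ t∈p t∈S →
          C-disjoint o (∈-induced p x∈C t∈p) (S⊆C j t∈S))))

    union-gp : IsGP (Adj G) ⊤ (S side₁ ∪ S side₂)
    union-gp = (λ _ → ∈⊤) , count≤2
      where
      count≤2 : ∀ x y k (w : Walk (Adj G) x y k) → IsDist (Adj G) x y k →
        countIn (S side₁ ∪ S side₂) (verts w) ≤ 2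
      count≤2 x y k w d with side-of x
      ... | i , j , o , x∈C with decompose d w x∈C
      ...   | within p eq = subst (λ vs → countIn _ vs ≤ 2) eq (≤-trans (countIn-one-side o p x∈C)
                (proj₂ (proj₁ (S-colinear i)) x y k p (geodesic-Gᵢ d p)))
      ...   | across o′ p q len eq with Opposite-unique o o′
      ...     | refl = subst (λ vs → countIn _ vs ≤ 2) (sym eq) (begin
        countIn S₁∪S₂ (verts p ++ verts q)             ≡⟨ countIn-++ S₁∪S₂ (verts p) (verts q) ⟩
        countIn S₁∪S₂ (verts p) + countIn S₁∪S₂ (verts q) ≤⟨ +-mono-≤ p-count q-count ⟩
        2                                               ∎)
        where
        open ≤-Reasoning
        S₁∪S₂ : Subset n
        S₁∪S₂ = S side₁ ∪ S side₂
        geodesics : IsDist (Gᵢ i) x (u i) _ × IsDist (Gᵢ j) (u j) y _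
        geodesics = across-geodesics d o p q len
        p-count : countIn S₁∪S₂ (verts p) ≤ 1
        p-count = ≤-trans (countIn-one-side o p x∈C)
                    (colinear-count≤1 (S-colinear i) (proj₁ geodesics) p)
        q-count : countIn S₁∪S₂ (verts q) ≤ 1
        q-count = ≤-trans (countIn-one-side (Opposite-sym o) q (u∈C j)) (begin
          countIn (S j) (verts q)                    ≡⟨ countIn-reverse (S j) (verts q) ⟨
          countIn (S j) (reverse (verts q))          ≡⟨ cong (countIn (S j)) (verts-reverseʷ Gᵢ-sym q) ⟨
          countIn (S j) (verts (reverseʷ Gᵢ-sym q))  ≤⟨ colinear-count≤1 (S-colinear j)
                                                          (dist-sym Gᵢ-sym (proj₂ geodesics))
                                                          (reverseʷ Gᵢ-sym q) ⟩
          1                                          ∎)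

    union-card : ∣ S side₁ ∪ S side₂ ∣ ≡ ∣ S side₁ ∣ + ∣ S side₂ ∣
    union-card = ∣p∪q∣≡∣p∣+∣q∣ (S side₁) (S side₂) λ (v , v∈S₁∩S₂) →
      C-disjoint o₁₂ (S⊆C side₁ (proj₁ (x∈p∩q⁻ _ _ v∈S₁∩S₂))) (S⊆C side₂ (proj₂ (x∈p∩q⁻ _ _ v∈S₁∩S₂)))

  module _ (ξ : Side → ℕ) (ξ-is : ∀ i → IsXi (Gᵢ i) (C i) (u i) (ξ i)) where

    private
      ξ-max : ∀ i S → IsColinear (Gᵢ i) (C i) (u i) S → ∣ S ∣ ≤ ξ i
      ξ-max i = proj₂ (ξ-is i)

    lower-bound : ∀ {g} → IsGpNumber G g → ξ side₁ + ξ side₂ ≤ g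
    lower-bound {g} (_ , gp-max) = begin
      ξ side₁ + ξ side₂          ≡⟨ cong₂ _+_ (∣S∣≡ξ side₁) (∣S∣≡ξ side₂) ⟨
      ∣ S side₁ ∣ + ∣ S side₂ ∣   ≡⟨ union-card S S-colinear ⟨
      ∣ S side₁ ∪ S side₂ ∣       ≤⟨ gp-max _ (union-gp S S-colinear) ⟩
      g                          ∎
      where
      open ≤-Reasoning
      S : Side → Subset n
      S i = proj₁ (proj₁ (ξ-is i))
      S-colinear : ∀ i → IsColinear (Gᵢ i) (C i) (u i) (S i)
      S-colinear i = proj₁ (proj₂ (proj₁ (ξ-is i)))
      ∣S∣≡ξ : ∀ i → ∣ S i ∣ ≡ ξ i
      ∣S∣≡ξ i = proj₂ (proj₂ (proj₁ (ξ-is i)))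

    -- a neighbour of u i other than the other end of the bridge forms a u i-colinear singleton
    ξ-positive : ∀ i → 2 ≤ degree G (u i) → 1 ≤ ξ i
    ξ-positive i 2≤deg with opposite i
    ... | j , o with 2≤∣p∣⇒other-element (tabulate (E G (u i))) (u j) 2≤deg
    ...   | w , w∈N , w≢u = subst (_≤ ξ i) (∣⁅x⁆∣≡1 w)
              (ξ-max i ⁅ w ⁆ (⁅⁆-colinear w∈C (Adj-irrefl G u~w ∘ sym)))
      where
      u~w : Adj G (u i) w
      u~w = trans (sym (lookup∘tabulate (E G (u i)) w)) ([]=⇒lookup w∈N)
      w∈C : w ∈ C i
      w∈C = C-closed (u∈C i) (edge-at-u o u~w w≢u)

    module _ (degree-u : ∀ i → 2 ≤ degree G (u i)) {X : Subset n} (X-gp : IsGP (Adj G) ⊤ X) where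

      private
        gp-restrict : ∀ {i Y} → Y ⊆ X → Y ⊆ C i → IsGP (Gᵢ i) (C i) Y
        gp-restrict Y⊆X Y⊆C = Y⊆C , λ x y k w d →
          ≤-trans (countIn-mono Y⊆X (verts w))
            (subst (λ vs → countIn X vs ≤ 2) (verts-mapʷ _ w)
              (proj₂ X-gp x y k (lift w) (dist-Gᵢ⇒dist d)))

        interval-Gᵢ⇒interval : InInterval (Gᵢ i) x (u i) y → InInterval (Adj G) x (u i) y
        interval-Gᵢ⇒interval (a , b , c , d-xu , d-xy , d-yu , e) =
          a , b , c , dist-Gᵢ⇒dist d-xu , dist-Gᵢ⇒dist d-xy , dist-Gᵢ⇒dist d-yu , e

        beyond-bridge⇒⊥ : Opposite i j → z ∈ X → z ∈ C j → x ∈ C i → IsDist (Gᵢ i) x (u i) k →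
          (p : Walk (Gᵢ i) x (u i) k) → y ∈ᴸ verts p → x ≢ y → x ∈ X → y ∈ X → ⊥
        beyond-bridge⇒⊥ {i = i} {z = z} {x = x} {k = k} {y = y} o z∈X z∈C x∈C d p y∈p x≢y x∈X y∈X
          with dist-from-u z∈C
        ... | l , q-geo@(q , _) =
          no-three-on-geodesic X-gp W (dist-across o x∈C d q-geo) x≢y (off-side y∈C) (off-side x∈C)
            (start∈verts W) (∈-++ʷ⁺ˡ (lift p) (subst (_ ∈ᴸ_) (sym (verts-mapʷ _ p)) y∈p)) (end∈verts W)
            x∈X y∈X z∈X
          where
          W : Walk (Adj G) x z (k + suc l)
          W = lift p ++ʷ cons (bridge-edge o) (lift q)
          y∈C : y ∈ C i
          y∈C = ∈-induced p x∈C y∈p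
          off-side : v ∈ C i → v ≢ z
          off-side v∈C refl = C-disjoint o v∈C z∈C

        empty-trace⇒⊆ : Opposite i j → Empty (X ∩ C j) → X ⊆ C i
        empty-trace⇒⊆ o X∩C-empty {v} v∈X with C-cover o v
        ... | inj₁ v∈C = v∈C
        ... | inj₂ v∈C = ⊥-elim (X∩C-empty (v , x∈p∩q⁺ (v∈X , v∈C)))

      trace-bound : Opposite i j → Nonempty (X ∩ C j) → ∣ X ∩ C i ∣ ≤ ξ i
      trace-bound {i} {j} o (z , z∈X∩C) with x∈p∩q⁻ X (C j) z∈X∩C | u i ∈? X
      ... | z∈X , z∈C | yes u∈X = begin
        ∣ X ∩ C i ∣    ≤⟨ p⊆q⇒∣p∣≤∣q∣ ⊆⁅u⁆ ⟩
        ∣ ⁅ u i ⁆ ∣    ≡⟨ ∣⁅x⁆∣≡1 (u i) ⟩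
        1             ≤⟨ ξ-positive i (degree-u i) ⟩
        ξ i           ∎
        where
        open ≤-Reasoning
        ⊆⁅u⁆ : X ∩ C i ⊆ ⁅ u i ⁆
        ⊆⁅u⁆ {v} v∈ with x∈p∩q⁻ X (C i) v∈ | v ≟ᶠ u i
        ... | _ | yes refl = x∈⁅x⁆ (u i)
        ... | v∈X , v∈C | no v≢u with dist-to-u v∈C
        ...   | _ , p-geo@(p , _) =
          ⊥-elim (beyond-bridge⇒⊥ o z∈X z∈C v∈C p-geo p (end∈verts p) v≢u v∈X u∈X)
      ... | z∈X , z∈C | no u∉X =
        ξ-max i (X ∩ C i) (gp-restrict (p∩q⊆p X (C i)) (p∩q⊆q X (C i)) , u∉X ∘ p∩q⊆p X (C i) , free)
        where
        free : IntervalFree (Gᵢ i) (u i) (X ∩ C i)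
        free x y x∈ y∈ x≢y I with interval⇒geodesic I
        ... | _ , g , g-geo , y∈g = beyond-bridge⇒⊥ o z∈X z∈C (p∩q⊆q X (C i) x∈) g-geo g y∈g x≢y
                                      (p∩q⊆p X (C i) x∈) (p∩q⊆p X (C i) y∈)

      one-sided-bound : IsBlockGraph G → X ⊆ C i → ∣ X ∣ ≤ ξ i + 1
      one-sided-bound {i} block-graph X⊆C = decidable-stable (∣ X ∣ ≤? ξ i + 1)
        (¬¬-map bound (removable-vertex G block-graph connected X-gp (u i)))
        where
        bound : ∃[ y₀ ] u i ∉ X - y₀ × IntervalFree (Adj G) (u i) (X - y₀) → ∣ X ∣ ≤ ξ i + 1
        bound (y₀ , u∉X-y₀ , free) = ≤-trans (∣p∣≤∣p-x∣+1 X y₀) (+-monoˡ-≤ 1 (ξ-max i (X - y₀) colinear))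
          where
          colinear : IsColinear (Gᵢ i) (C i) (u i) (X - y₀)
          colinear = gp-restrict x∈p-y⇒x∈p (X⊆C ∘ x∈p-y⇒x∈p) , u∉X-y₀ ,
                     λ x y x∈ y∈ x≢y I → free x y x∈ y∈ x≢y (interval-Gᵢ⇒interval I)

      upper-bound : IsBlockGraph G → ∣ X ∣ ≤ ξ side₁ + ξ side₂
      upper-bound block-graph with nonempty? (X ∩ C side₁) | nonempty? (X ∩ C side₂)
      ... | yes meets-C₁ | yes meets-C₂ = begin
        ∣ X ∣                     ≡⟨ ∣p─q∣+∣p∩q∣≡∣p∣ X C₂ ⟨
        ∣ X ─ C₂ ∣ + ∣ X ∩ C₂ ∣    ≤⟨ +-monoˡ-≤ ∣ X ∩ C₂ ∣ (p⊆q⇒∣p∣≤∣q∣ X─C₂⊆X∩C₁) ⟩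
        ∣ X ∩ C₁ ∣ + ∣ X ∩ C₂ ∣    ≤⟨ +-mono-≤ (trace-bound o₁₂ meets-C₂) (trace-bound o₂₁ meets-C₁) ⟩
        ξ side₁ + ξ side₂         ∎
        where
        open ≤-Reasoning
        X─C₂⊆X∩C₁ : X ─ C₂ ⊆ X ∩ C₁
        X─C₂⊆X∩C₁ {v} v∈ with C-cover o₁₂ v
        ... | inj₁ v∈C₁ = x∈p∩q⁺ (p─q⊆p X C₂ v∈ , v∈C₁)
        ... | inj₂ v∈C₂ = ⊥-elim (x∈p─q⇒x∉q v∈ v∈C₂)
      ... | _ | no X∩C₂-empty = ≤-trans (one-sided-bound block-graph (empty-trace⇒⊆ o₁₂ X∩C₂-empty))
                                  (+-monoʳ-≤ (ξ side₁) (ξ-positive side₂ (degree-u side₂)))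
      ... | no X∩C₁-empty | yes _ = begin
        ∣ X ∣                ≤⟨ one-sided-bound block-graph (empty-trace⇒⊆ o₂₁ X∩C₁-empty) ⟩
        ξ side₂ + 1          ≡⟨ +-comm (ξ side₂) 1 ⟩
        1 + ξ side₂          ≤⟨ +-monoˡ-≤ (ξ side₂) (ξ-positive side₁ (degree-u side₁)) ⟩
        ξ side₁ + ξ side₂    ∎
        where open ≤-Reasoning

proposition3p3 : ∀ {n} (G : Graph n) → ConnectedGraph G →
    (u₁ u₂ : Fin n) → IsBridge G u₁ u₂ → 2 ≤ degree G u₁ → 2 ≤ degree G u₂ →
    (C₁ C₂ : Subset n) →
    IsComponentOf (AdjMinus G u₁ u₂) u₁ C₁ → IsComponentOf (AdjMinus G u₁ u₂) u₂ C₂ →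
    (g x₁ x₂ : ℕ) → IsGpNumber G g →
    IsXi (Induced (AdjMinus G u₁ u₂) (_∈ C₁)) C₁ u₁ x₁ →
    IsXi (Induced (AdjMinus G u₁ u₂) (_∈ C₂)) C₂ u₂ x₂ →
    (x₁ + x₂ ≤ g) × (IsBlockGraph G → g ≡ x₁ + x₂)
proposition3p3 G connected u₁ u₂ bridge degree-u₁ degree-u₂ C₁ C₂ C₁-component C₂-component
  g x₁ x₂ g-is@((X , X-gp , ∣X∣≡g) , _) x₁-is x₂-is =
  lower , λ block-graph →
    ≤-antisym (subst (_≤ x₁ + x₂) ∣X∣≡g (upper-bound ξ ξ-is degree-u X-gp block-graph)) lower
  where
  open Bridge G connected u₁ u₂ bridge C₁ C₂ C₁-component C₂-component
  ξ : Side → ℕ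
  ξ side₁ = x₁
  ξ side₂ = x₂
  ξ-is : ∀ i → IsXi (Gᵢ i) (C i) (u i) (ξ i)
  ξ-is side₁ = x₁-is
  ξ-is side₂ = x₂-is
  degree-u : ∀ i → 2 ≤ degree G (u i)
  degree-u side₁ = degree-u₁
  degree-u side₂ = degree-u₂
  lower : x₁ + x₂ ≤ g
  lower = lower-bound ξ ξ-is g-is
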